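{- (Pair existence.) Let $\Sigma$ be a signature with a finite set of constants $C$, and $\Phi$ a finite set of closed formulas in the language of $\Sigma$. If $p$ is a $\mathrm{Cl}_C(\Phi)$-MCW pair and $\Diamond\varphi\in p^+$, then there exist a finite set of constants $D\supseteq C$ and a $\mathrm{Cl}_D(\Phi)$-MCW pair $q$ such that $p\hat Rq$, $\varphi\in q^+$, and $\mathrm{md}(q^+)<\mathrm{md}(p^+)$.
   Context: Formulas and derivability $\varphi\vdash\psi$ are those of the calculus $\mathsf{QRC_1}$: over a signature of constants and relation symbols (no function symbols), formulas are built from $\top$ and atomic $S(t_0,\dots,t_{n-1})$ ($t_i$ variables or constants) by $\wedge$, $\Diamond$, $\forall x$; $\mathsf{QRC_1}$ has the axioms $\varphi\vdash\top$, $\varphi\vdash\varphi$, $\varphi\wedge\psi\vdash\varphi$, $\varphi\wedge\psi\vdash\psi$, $\Diamond\Diamond\varphi\vdash\Diamond\varphi$, $\Diamond\forall x\varphi\vdash\forall x\Diamond\varphi$, and the rules: from $\varphi\vdash\psi,\varphi\vdash\chi$ infer $\varphi\vdash\psi\wedge\chi$; from $\varphi\vdash\psi,\psi\vdash\chi$ infer $\varphi\vdash\chi$; from $\varphi\vdash\psi$ infer $\Diamond\varphi\vdash\Diamond\psi$; from $\varphi\vdash\psi$ infer $\varphi\vdash\forall x\psi$ ($x$ not free in $\varphi$); from $\varphi[x\leftarrow t]\vdash\psi$ infer $\forall x\varphi\vdash\psi$ ($t$ free for $x$ in $\varphi$); from $\varphi\vdash\psi$ infer $\varphi[x\leftarrow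 t]\vdash\psi[x\leftarrow t]$ ($t$ free for $x$ in $\varphi,\psi$); from $\varphi[x\leftarrow c]\vdash\psi[x\leftarrow c]$ infer $\varphi\vdash\psi$ ($c$ not in $\varphi,\psi$). $\Gamma\vdash\varphi$ means $\gamma_0\wedge\dots\wedge\gamma_n\vdash\varphi$ for some $\gamma_i\in\Gamma$. A pair is $p=\langle p^+,p^-\rangle$ of sets of formulas; $p$ is consistent if $p^+\not\vdash\delta$ for all $\delta\in p^-$. For a set $\Psi$, a pair inside $\Psi$ is $\Psi$-maximal consistent if it is consistent and has no consistent extension $q\ne p$ with $p^\pm\subseteq q^\pm\subseteq\Psi$; it is fully witnessed if for every $\forall x\varphi\in p^-$ there is a constant $c$ with $\varphi[x\leftarrow c]\in p^-$; $\Psi$-MCW means $\Psi$-maximal consistent and fully witnessed. Closure under constants $C$: $\mathrm{Cl}_C(\top)=\{\top\}$; $\mathrm{Cl}_C(S(t_0,\dots,t_{n-1}))=\{S(t_0,\dots,t_{n-1}),\top\}$; $\mathrm{Cl}_C(\varphi\wedge\psi)=\{\varphi\wedge\psi\}\cup\mathrm{Cl}_C(\varphi)\cup\mathrm{Cl}_C(\psi)$; $\mathrm{Cl}_C(\Diamond\varphi)=\{\Diamond\varphi\}\cup\mathrm{Cl}_C(\varphi)$; $\mathrm{Cl}_C(\forall x\varphi)=\{\forall x\varphi\}\cup\bigcup_{c\in C}\mathrm{Cl}_C(\varphi[x\leftarrow c])$; $\mathrm{Cl}_C(\Gamma)=\bigcup_{\gamma\in\Gamma}\mathrm{Cl}_C(\gamma)$.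 Modal depth: $\mathrm{md}(\top)=\mathrm{md}(S(\dots))=0$, $\mathrm{md}(\psi\wedge\chi)=\max\{\mathrm{md}(\psi),\mathrm{md}(\chi)\}$, $\mathrm{md}(\forall x\psi)=\mathrm{md}(\psi)$, $\mathrm{md}(\Diamond\psi)=\mathrm{md}(\psi)+1$; for a finite set, the maximum over its elements. The relation $\hat R$: $p\hat Rq$ iff (i) for every $\Diamond\varphi\in p^-$ we have $\varphi,\Diamond\varphi\in q^-$, and (ii) there is some $\Diamond\psi\in p^+\cap q^-$. -}

module Defs where

open import Data.Nat using (ℕ; _≡ᵇ_; _⊔_)
open import Data.Bool using (Bool; true; false; _∧_; _∨_; not; if_then_else_)
open import Data.Vec using (Vec; []; _∷_)
open import Data.List using (List; []; _∷_; foldr)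
open import Data.List.Membership.Propositional using (_∈_)
open import Data.Product using (Σ; _×_; ∃; ∃-syntax)
open import Relation.Binary.PropositionalEquality using (_≡_)

-- Variables and constants are named by natural numbers
-- (an infinite supply of constants); a relation symbol is a pair of an
-- arity n and a name r : ℕ, applied to a vector of n terms.

data Term : Set where
  var : ℕ → Term
  con : ℕ → Term

infixr 6 _∧'_
data Formula : Set where
  ⊤'    : Formula
  atom  : (n r : ℕ) → Vec Term n → Formula
  _∧'_  : Formula → Formula → Formula
  ◇     : Formula → Formula
  ∀'    : ℕ → Formula → Formula

substT : ℕ → Term → Term → Term
substT x t (var y) = if x ≡ᵇ y then t else var y
substT x t (con c) = con c

substTs : ∀ {n} → ℕ → Term → Vec Term n → Vec Term n
substTs x t [] = []
substTs x t (u ∷ us) = substT x t u ∷ substTs x t us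

_[_←_] : Formula → ℕ → Term → Formula
⊤' [ x ← t ] = ⊤'
atom n r ts [ x ← t ] = atom n r (substTs x t ts)
(φ ∧' ψ) [ x ← t ] = (φ [ x ← t ]) ∧' (ψ [ x ← t ])
◇ φ [ x ← t ] = ◇ (φ [ x ← t ])
∀' y φ [ x ← t ] = if x ≡ᵇ y then ∀' y φ else ∀' y (φ [ x ← t ])

varInT : ℕ → Term → Bool
varInT x (var y) = x ≡ᵇ y
varInT x (con c) = false

varInTs : ∀ {n} → ℕ → Vec Term n → Bool
varInTs x [] = false
varInTs x (u ∷ us) = varInT x u ∨ varInTs x us

freeIn : ℕ → Formula → Bool
freeIn x ⊤' = false
freeIn x (atom n r ts) = varInTs x ts
freeIn x (φ ∧' ψ) = freeIn x φ ∨ freeIn x ψ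
freeIn x (◇ φ) = freeIn x φ
freeIn x (∀' y φ) = not (x ≡ᵇ y) ∧ freeIn x φ

freeFor : Term → ℕ → Formula → Bool
freeFor t x ⊤' = true
freeFor t x (atom n r ts) = true
freeFor t x (φ ∧' ψ) = freeFor t x φ ∧ freeFor t x ψ
freeFor t x (◇ φ) = freeFor t x φ
freeFor t x (∀' y φ) =
  not (freeIn x (∀' y φ)) ∨ (not (varInT y t) ∧ freeFor t x φ)

conInT : ℕ → Term → Bool
conInT c (var y) = false
conInT c (con d) = c ≡ᵇ d

conInTs : ∀ {n} → ℕ → Vec Term n → Bool
conInTs c [] = false
conInTs c (u ∷ us) = conInT c u ∨ conInTs c us

conIn : ℕ → Formula → Bool
conIn c ⊤' = false
conIn c (atom n r ts) = conInTs c ts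
conIn c (φ ∧' ψ) = conIn c φ ∨ conIn c ψ
conIn c (◇ φ) = conIn c φ
conIn c (∀' y φ) = conIn c φ

infix 4 _⊢_
data _⊢_ : Formula → Formula → Set where
  ax⊤    : ∀ {φ} → φ ⊢ ⊤'
  ax-id  : ∀ {φ} → φ ⊢ φ
  ax-∧l  : ∀ {φ ψ} → φ ∧' ψ ⊢ φ
  ax-∧r  : ∀ {φ ψ} → φ ∧' ψ ⊢ ψ
  ax-◇◇  : ∀ {φ} → ◇ (◇ φ) ⊢ ◇ φ
  ax-◇∀  : ∀ {x φ} → ◇ (∀' x φ) ⊢ ∀' x (◇ φ)
  r-∧    : ∀ {φ ψ χ} → φ ⊢ ψ → φ ⊢ χ → φ ⊢ ψ ∧' χ
  r-cut  : ∀ {φ ψ χ} → φ ⊢ ψ → ψ ⊢ χ → φ ⊢ χ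
  r-◇    : ∀ {φ ψ} → φ ⊢ ψ → ◇ φ ⊢ ◇ ψ
  r-∀R   : ∀ {φ ψ x} → freeIn x φ ≡ false → φ ⊢ ψ → φ ⊢ ∀' x ψ
  r-∀L   : ∀ {φ ψ x t} → freeFor t x φ ≡ true →
           φ [ x ← t ] ⊢ ψ → ∀' x φ ⊢ ψ
  r-sub  : ∀ {φ ψ x t} → freeFor t x φ ≡ true → freeFor t x ψ ≡ true →
           φ ⊢ ψ → φ [ x ← t ] ⊢ ψ [ x ← t ]
  r-con  : ∀ {φ ψ x c} → conIn c φ ≡ false → conIn c ψ ≡ false →
           φ [ x ← con c ] ⊢ ψ [ x ← con c ] → φ ⊢ ψ

-- Finite sets of formulas are represented by lists.

_⊆_ : {A : Set} → List A → List A → Set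
xs ⊆ ys = ∀ {a} → a ∈ xs → a ∈ ys

conj : Formula → List Formula → Formula
conj γ [] = γ
conj γ (δ ∷ δs) = γ ∧' conj δ δs

_⊢s_ : List Formula → Formula → Set
Γ ⊢s φ = Σ Formula λ γ → Σ (List Formula) λ γs →
         (γ ∈ Γ) × (γs ⊆ Γ) × (conj γ γs ⊢ φ)

record Pair : Set where
  constructor ⟨_,_⟩
  field
    pos : List Formula
    neg : List Formula
open Pair public

Consistent : Pair → Set
Consistent p = ∀ {δ} → δ ∈ neg p → (pos p ⊢s δ → Data.Empty.⊥)
  where import Data.Empty

FullyWitnessed : Pair → Set
FullyWitnessed p = ∀ {x φ} → ∀' x φ ∈ neg p → ∃[ c ] (φ [ x ← con c ] ∈ neg p)

-- Closure: InCl C ψ φ means ψ ∈ Cl_C(φ) (least set satisfying the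
-- recursive clauses of the definition).

data InCl (C : List ℕ) : Formula → Formula → Set where
  here  : ∀ {φ} → InCl C φ φ
  atom⊤ : ∀ {n r ts} → InCl C ⊤' (atom n r ts)
  ∧l    : ∀ {χ φ ψ} → InCl C χ φ → InCl C χ (φ ∧' ψ)
  ∧r    : ∀ {χ φ ψ} → InCl C χ ψ → InCl C χ (φ ∧' ψ)
  ◇in   : ∀ {χ φ} → InCl C χ φ → InCl C χ (◇ φ)
  ∀in   : ∀ {χ x φ c} → c ∈ C → InCl C χ (φ [ x ← con c ]) → InCl C χ (∀' x φ)

InClSet : List ℕ → List Formula → Formula → Set
InClSet C Φ ψ = ∃[ γ ] (γ ∈ Φ × InCl C ψ γ)

InsideCl : List ℕ → List Formula → Pair → Set
InsideCl C Φ p = (∀ {ψ} → ψ ∈ pos p → InClSet C Φ ψ) ×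
                 (∀ {ψ} → ψ ∈ neg p → InClSet C Φ ψ)

MaxConsCl : List ℕ → List Formula → Pair → Set
MaxConsCl C Φ p = InsideCl C Φ p × Consistent p ×
  (∀ q → Consistent q → pos p ⊆ pos q → neg p ⊆ neg q → InsideCl C Φ q →
     (pos q ⊆ pos p) × (neg q ⊆ neg p))

ClMCW : List ℕ → List Formula → Pair → Set
ClMCW C Φ p = MaxConsCl C Φ p × FullyWitnessed p

md : Formula → ℕ
md ⊤' = 0
md (atom n r ts) = 0
md (φ ∧' ψ) = md φ ⊔ md ψ
md (∀' x φ) = md φ
md (◇ φ) = Data.Nat.suc (md φ)

mdSet : List Formula → ℕ
mdSet = foldr (λ φ m → md φ ⊔ m) 0

R̂ : Pair → Pair → Set
R̂ p q = (∀ {φ} → ◇ φ ∈ neg p → (φ ∈ neg q) × (◇ φ ∈ neg q)) ×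
        ∃[ ψ ] ((◇ ψ ∈ pos p) × (◇ ψ ∈ neg q))

Closed : Formula → Set
Closed φ = ∀ x → freeIn x φ ≡ false

-- φ is in the language of Σ with constants C
ConstsIn : List ℕ → Formula → Set
ConstsIn C φ = ∀ c → conIn c φ ≡ true → c ∈ C

-- Build a finite tree model of φ. Its domain D is C together with 2Q + 1 fresh
-- constants, Q bounding the quantifier depth of Φ; ∀ ranges over D and ◇ looks at
-- proper descendants. The canonical tree of φ has height md φ and makes φ true at
-- its root; q⁺ and q⁻ are the formulas of Cl_D(Φ) true and false there. Soundness
-- of QRC₁ for such trees makes q consistent; q is maximal because it decides the
-- whole closure, and fully witnessed because a false ∀ over the finite domain has a
-- false instance. Conversely, every formula of the closure true at the root is
-- derivable from φ (fresh constants discharge ∀ through r-con), so no ψ or ◇ ψ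
-- with ◇ ψ ∈ p⁻ is true there, since ◇ φ ∈ p⁺ would then derive ◇ ψ. The height
-- bound makes ◇ φ false at the root and gives md(q⁺) ≤ md φ < md(p⁺).

module Submission where

open import Defs
open import Data.Nat using (ℕ; zero; suc; _≡ᵇ_; _⊔_; _+_; _≤_; _<_; z≤n; s≤s)
open import Data.Nat.Properties
  using (≡ᵇ⇒≡; _≟_; ≤-refl; ≤-reflexive; ≤-trans; <⇒≢; ⊔-lub; m≤m⊔n; m≤n⊔m; m⊔n≤o⇒m≤o; m⊔n≤o⇒n≤o;
         m+n≤o⇒m≤o; m+n≤o⇒n≤o; m≤m+n; m≤n+m; m≤n⇒m≤1+n; n≤1+n; n<1+n; <-≤-trans; ≤-pred;
         +-mono-≤; +-suc; +-cancelˡ-≡)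
open import Data.Bool using (Bool; T; true; false; _∧_; _∨_; not; if_then_else_)
open import Data.Vec using (Vec; []; _∷_)
import Data.Vec.Properties as Vec
open import Data.List using (List; []; _∷_; _++_; map; concat; foldr; length; filter; applyUpTo)
open import Data.Bool.ListAction using (all)
open import Data.List.Properties using (length-++; filter-notAll)
open import Data.List.Extrema.Nat using (max; v<max⁺)
open import Data.List.Membership.Propositional using (_∈_; _∉_)
open import Data.List.Membership.Propositional.Properties
  using (∈-++⁺ˡ; ∈-++⁺ʳ; ∈-++⁻; ∈-map⁺; ∈-map⁻; ∈-concat⁺′; ∈-concat⁻′; ∈-filter⁺; ∈-filter⁻; ∈-applyUpTo⁺)
open import Data.List.Membership.DecPropositional _≟_ using (_∈?_)
open import Data.List.Relation.Unary.Any as Any using (here; there)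
open import Data.Product using (_×_; _,_; ∃-syntax; proj₁; proj₂)
open import Data.Sum using (_⊎_; inj₁; inj₂)
open import Data.Empty using (⊥; ⊥-elim)
open import Relation.Nullary using (¬?; Dec; yes; no; does)
open import Relation.Nullary.Decidable using (dec-true)
open import Relation.Binary.PropositionalEquality
open import Data.Bool.Properties using (¬-not) renaming (_≟_ to _≟ᵇ_)

∧-true⁻ˡ : ∀ {a b} → a ∧ b ≡ true → a ≡ true
∧-true⁻ˡ {true} _ = refl

∧-true⁻ʳ : ∀ {a b} → a ∧ b ≡ true → b ≡ true
∧-true⁻ʳ {true} e = e

∧-true⁺ : ∀ {a b} → a ≡ true → b ≡ true → a ∧ b ≡ true
∧-true⁺ refl refl = refl

∨-true⁻ : ∀ {a b} → a ∨ b ≡ true → a ≡ true ⊎ b ≡ true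
∨-true⁻ {true} _ = inj₁ refl
∨-true⁻ {false} e = inj₂ e

∨-true⁺ˡ : ∀ {a b} → a ≡ true → a ∨ b ≡ true
∨-true⁺ˡ refl = refl

∨-true⁺ʳ : ∀ {a b} → b ≡ true → a ∨ b ≡ true
∨-true⁺ʳ {true} _ = refl
∨-true⁺ʳ {false} e = e

∨-false⁻ˡ : ∀ {a b} → a ∨ b ≡ false → a ≡ false
∨-false⁻ˡ {false} _ = refl

∨-false⁻ʳ : ∀ {a b} → a ∨ b ≡ false → b ≡ false
∨-false⁻ʳ {false} e = e

not-true⇒false : ∀ {b} → not b ≡ true → b ≡ false
not-true⇒false {false} _ = refl

true≢false : true ≢ false
true≢false ()

true-⇔⇒≡ : ∀ {a b} → (a ≡ true → b ≡ true) → (b ≡ true → a ≡ true) → a ≡ b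
true-⇔⇒≡ {true} f g = sym (f refl)
true-⇔⇒≡ {false} {true} f g = g refl
true-⇔⇒≡ {false} {false} f g = refl

dec-true⁻ : ∀ {A : Set} (a? : Dec A) → does a? ≡ true → A
dec-true⁻ (yes a) _ = a

all-true⁺ : ∀ {A : Set} (f : A → Bool) xs → (∀ {x} → x ∈ xs → f x ≡ true) → all f xs ≡ true
all-true⁺ f [] h = refl
all-true⁺ f (x ∷ xs) h = ∧-true⁺ (h (here refl)) (all-true⁺ f xs (λ m → h (there m)))

all-true⁻ : ∀ {A : Set} (f : A → Bool) xs {x} → all f xs ≡ true → x ∈ xs → f x ≡ true
all-true⁻ f (x ∷ xs) e (here refl) = ∧-true⁻ˡ e
all-true⁻ f (x ∷ xs) e (there m) = all-true⁻ f xs (∧-true⁻ʳ e) m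

all-false⁻ : ∀ {A : Set} (f : A → Bool) xs → all f xs ≡ false → ∃[ x ] (x ∈ xs × f x ≡ false)
all-false⁻ f (x ∷ xs) e with f x in fx
... | false = x , here refl , fx
... | true with all-false⁻ f xs e
...   | y , m , fy = y , there m , fy

all-cong : ∀ {A : Set} {f g : A → Bool} xs → (∀ x → f x ≡ g x) → all f xs ≡ all g xs
all-cong [] h = refl
all-cong (x ∷ xs) h = cong₂ _∧_ (h x) (all-cong xs h)

≡ᵇ-true⇒≡ : ∀ {m n} → (m ≡ᵇ n) ≡ true → m ≡ n
≡ᵇ-true⇒≡ {m} {n} e = ≡ᵇ⇒≡ m n (subst T (sym e) _)

≡ᵇ-refl : ∀ n → (n ≡ᵇ n) ≡ true
≡ᵇ-refl zero = refl
≡ᵇ-refl (suc n) = ≡ᵇ-refl n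

≡ᵇ-false⇒≢ : ∀ {m n} → (m ≡ᵇ n) ≡ false → m ≢ n
≡ᵇ-false⇒≢ {m} e refl = true≢false (trans (sym (≡ᵇ-refl m)) e)

≢⇒≡ᵇ-false : ∀ {m n} → m ≢ n → (m ≡ᵇ n) ≡ false
≢⇒≡ᵇ-false {m} {n} m≢n with m ≡ᵇ n in e
... | true = ⊥-elim (m≢n (≡ᵇ-true⇒≡ e))
... | false = refl

≡ᵇ-sym : ∀ m n → (m ≡ᵇ n) ≡ (n ≡ᵇ m)
≡ᵇ-sym zero zero = refl
≡ᵇ-sym zero (suc n) = refl
≡ᵇ-sym (suc m) zero = refl
≡ᵇ-sym (suc m) (suc n) = ≡ᵇ-sym m n

-- Syntax

_≟ᵗ_ : (a b : Term) → Dec (a ≡ b)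
var x ≟ᵗ var y with x ≟ y
... | yes refl = yes refl
... | no x≢y = no λ { refl → x≢y refl }
var x ≟ᵗ con y = no λ ()
con x ≟ᵗ var y = no λ ()
con x ≟ᵗ con y with x ≟ y
... | yes refl = yes refl
... | no x≢y = no λ { refl → x≢y refl }

_≟ᶠ_ : (a b : Formula) → Dec (a ≡ b)
⊤' ≟ᶠ ⊤' = yes refl
⊤' ≟ᶠ atom _ _ _ = no λ ()
⊤' ≟ᶠ (_ ∧' _) = no λ ()
⊤' ≟ᶠ ◇ _ = no λ ()
⊤' ≟ᶠ ∀' _ _ = no λ ()
atom _ _ _ ≟ᶠ ⊤' = no λ ()
atom n r us ≟ᶠ atom n' r' us' with n ≟ n'
... | no ne = no λ { refl → ne refl }
... | yes refl with r ≟ r' | Vec.≡-dec _≟ᵗ_ us us'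
...   | yes refl | yes refl = yes refl
...   | no ne | _ = no λ { refl → ne refl }
...   | yes _ | no ne = no λ { refl → ne refl }
atom _ _ _ ≟ᶠ (_ ∧' _) = no λ ()
atom _ _ _ ≟ᶠ ◇ _ = no λ ()
atom _ _ _ ≟ᶠ ∀' _ _ = no λ ()
(_ ∧' _) ≟ᶠ ⊤' = no λ ()
(_ ∧' _) ≟ᶠ atom _ _ _ = no λ ()
(a ∧' b) ≟ᶠ (a' ∧' b') with a ≟ᶠ a' | b ≟ᶠ b'
... | yes refl | yes refl = yes refl
... | no ne | _ = no λ { refl → ne refl }
... | yes _ | no ne = no λ { refl → ne refl }
(_ ∧' _) ≟ᶠ ◇ _ = no λ ()
(_ ∧' _) ≟ᶠ ∀' _ _ = no λ ()
◇ _ ≟ᶠ ⊤' = no λ ()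
◇ _ ≟ᶠ atom _ _ _ = no λ ()
◇ _ ≟ᶠ (_ ∧' _) = no λ ()
◇ a ≟ᶠ ◇ b with a ≟ᶠ b
... | yes refl = yes refl
... | no ne = no λ { refl → ne refl }
◇ _ ≟ᶠ ∀' _ _ = no λ ()
∀' _ _ ≟ᶠ ⊤' = no λ ()
∀' _ _ ≟ᶠ atom _ _ _ = no λ ()
∀' _ _ ≟ᶠ (_ ∧' _) = no λ ()
∀' _ _ ≟ᶠ ◇ _ = no λ ()
∀' x a ≟ᶠ ∀' y b with x ≟ y | a ≟ᶠ b
... | yes refl | yes refl = yes refl
... | no ne | _ = no λ { refl → ne refl }
... | yes _ | no ne = no λ { refl → ne refl }

open import Data.List.Membership.DecPropositional _≟ᶠ_ using () renaming (_∈?_ to _∈ᶠ?_)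

size : Formula → ℕ
size ⊤' = 1
size (atom n r ts) = 1
size (a ∧' b) = suc (size a + size b)
size (◇ a) = suc (size a)
size (∀' x a) = suc (size a)

1≤size : ∀ a → 1 ≤ size a
1≤size ⊤' = s≤s z≤n
1≤size (atom n r ts) = s≤s z≤n
1≤size (a ∧' b) = s≤s z≤n
1≤size (◇ a) = s≤s z≤n
1≤size (∀' x a) = s≤s z≤n

quantifierDepth : Formula → ℕ
quantifierDepth ⊤' = 0
quantifierDepth (atom n r ts) = 0
quantifierDepth (a ∧' b) = quantifierDepth a ⊔ quantifierDepth b
quantifierDepth (◇ a) = quantifierDepth a
quantifierDepth (∀' x a) = suc (quantifierDepth a)

size-[←] : ∀ a x t → size (a [ x ← t ]) ≡ size a
size-[←] ⊤' x t = refl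
size-[←] (atom n r ts) x t = refl
size-[←] (a ∧' b) x t = cong₂ (λ u v → suc (u + v)) (size-[←] a x t) (size-[←] b x t)
size-[←] (◇ a) x t = cong suc (size-[←] a x t)
size-[←] (∀' y a) x t with x ≡ᵇ y
... | true = refl
... | false = cong suc (size-[←] a x t)

quantifierDepth-[←] : ∀ a x t → quantifierDepth (a [ x ← t ]) ≡ quantifierDepth a
quantifierDepth-[←] ⊤' x t = refl
quantifierDepth-[←] (atom n r ts) x t = refl
quantifierDepth-[←] (a ∧' b) x t = cong₂ _⊔_ (quantifierDepth-[←] a x t) (quantifierDepth-[←] b x t)
quantifierDepth-[←] (◇ a) x t = quantifierDepth-[←] a x t
quantifierDepth-[←] (∀' y a) x t with x ≡ᵇ y
... | true = refl
... | false = cong suc (quantifierDepth-[←] a x t)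

md-[←] : ∀ a x t → md (a [ x ← t ]) ≡ md a
md-[←] ⊤' x t = refl
md-[←] (atom n r ts) x t = refl
md-[←] (a ∧' b) x t = cong₂ _⊔_ (md-[←] a x t) (md-[←] b x t)
md-[←] (◇ a) x t = cong suc (md-[←] a x t)
md-[←] (∀' y a) x t with x ≡ᵇ y
... | true = refl
... | false = md-[←] a x t

substTs-fresh : ∀ {n} x t (us : Vec Term n) → varInTs x us ≡ false → substTs x t us ≡ us
substTs-fresh x t [] e = refl
substTs-fresh x t (var y ∷ us) e with x ≡ᵇ y
... | false = cong (var y ∷_) (substTs-fresh x t us e)
substTs-fresh x t (con c ∷ us) e = cong (con c ∷_) (substTs-fresh x t us e)

[←]-fresh : ∀ a x t → freeIn x a ≡ false → a [ x ← t ] ≡ a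
[←]-fresh ⊤' x t e = refl
[←]-fresh (atom n r us) x t e = cong (atom n r) (substTs-fresh x t us e)
[←]-fresh (a ∧' b) x t e = cong₂ _∧'_ ([←]-fresh a x t (∨-false⁻ˡ e)) ([←]-fresh b x t (∨-false⁻ʳ e))
[←]-fresh (◇ a) x t e = cong ◇ ([←]-fresh a x t e)
[←]-fresh (∀' y a) x t e with x ≡ᵇ y
... | true = refl
... | false = cong (∀' y) ([←]-fresh a x t e)

freeFor-con : ∀ a x c → freeFor (con c) x a ≡ true
freeFor-con ⊤' x c = refl
freeFor-con (atom n r ts) x c = refl
freeFor-con (a ∧' b) x c = ∧-true⁺ (freeFor-con a x c) (freeFor-con b x c)
freeFor-con (◇ a) x c = freeFor-con a x c
freeFor-con (∀' y a) x c = ∨-true⁺ʳ (freeFor-con a x c)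

varInTs-[←con] : ∀ {n} z x c (us : Vec Term n) → varInTs z (substTs x (con c) us) ≡ true →
  z ≢ x × varInTs z us ≡ true
varInTs-[←con] z x c (var y ∷ us) e with x ≡ᵇ y in x≟y
... | true = Data.Product.map₂ ∨-true⁺ʳ (varInTs-[←con] z x c us e)
... | false with ∨-true⁻ e
...   | inj₁ z≡y = (λ { refl → ≡ᵇ-false⇒≢ {x} {y} x≟y (≡ᵇ-true⇒≡ z≡y) }) , ∨-true⁺ˡ z≡y
...   | inj₂ e′ = Data.Product.map₂ ∨-true⁺ʳ (varInTs-[←con] z x c us e′)
varInTs-[←con] z x c (con d ∷ us) e = varInTs-[←con] z x c us e

freeIn-[←con] : ∀ a z x c → freeIn z (a [ x ← con c ]) ≡ true → z ≢ x × freeIn z a ≡ true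
freeIn-[←con] (atom n r us) z x c e = varInTs-[←con] z x c us e
freeIn-[←con] (a ∧' b) z x c e with ∨-true⁻ e
... | inj₁ e′ = Data.Product.map₂ ∨-true⁺ˡ (freeIn-[←con] a z x c e′)
... | inj₂ e′ = Data.Product.map₂ ∨-true⁺ʳ (freeIn-[←con] b z x c e′)
freeIn-[←con] (◇ a) z x c e = freeIn-[←con] a z x c e
freeIn-[←con] (∀' y a) z x c e with x ≡ᵇ y in x≟y
... | true = (λ { refl → true≢false (trans (sym (∧-true⁻ˡ e)) (cong not x≟y)) }) , e
... | false = Data.Product.map₂ (∧-true⁺ (∧-true⁻ˡ e)) (freeIn-[←con] a z x c (∧-true⁻ʳ e))

Closed-[←con] : ∀ x a c → Closed (∀' x a) → Closed (a [ x ← con c ])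
Closed-[←con] x a c closed z with freeIn z (a [ x ← con c ]) in e
... | false = refl
... | true with freeIn-[←con] a z x c e
...   | z≢x , free = ⊥-elim (true≢false (trans (sym (∧-true⁺ (cong not (≢⇒≡ᵇ-false z≢x)) free)) (closed z)))

Closed-∧ˡ : ∀ {a b} → Closed (a ∧' b) → Closed a
Closed-∧ˡ closed z = ∨-false⁻ˡ (closed z)

Closed-∧ʳ : ∀ {a b} → Closed (a ∧' b) → Closed b
Closed-∧ʳ closed z = ∨-false⁻ʳ (closed z)

conInTs-[←con] : ∀ {n} e x c (us : Vec Term n) → conInTs e (substTs x (con c) us) ≡ true →
  e ≡ c ⊎ conInTs e us ≡ true
conInTs-[←con] e x c (var y ∷ us) h with x ≡ᵇ y
... | false = conInTs-[←con] e x c us h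
... | true with ∨-true⁻ h
...   | inj₁ e≡c = inj₁ (≡ᵇ-true⇒≡ e≡c)
...   | inj₂ h′ = conInTs-[←con] e x c us h′
conInTs-[←con] e x c (con d ∷ us) h with ∨-true⁻ h
... | inj₁ e≡d = inj₂ (∨-true⁺ˡ e≡d)
... | inj₂ h′ = Data.Sum.map₂ ∨-true⁺ʳ (conInTs-[←con] e x c us h′)

conIn-[←con] : ∀ a e x c → conIn e (a [ x ← con c ]) ≡ true → e ≡ c ⊎ conIn e a ≡ true
conIn-[←con] (atom n r us) e x c h = conInTs-[←con] e x c us h
conIn-[←con] (a ∧' b) e x c h with ∨-true⁻ h
... | inj₁ h′ = Data.Sum.map₂ ∨-true⁺ˡ (conIn-[←con] a e x c h′)
... | inj₂ h′ = Data.Sum.map₂ ∨-true⁺ʳ (conIn-[←con] b e x c h′)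
conIn-[←con] (◇ a) e x c h = conIn-[←con] a e x c h
conIn-[←con] (∀' y a) e x c h with x ≡ᵇ y
... | true = inj₂ h
... | false = conIn-[←con] a e x c h

ConstsIn-[←con] : ∀ {D x a c} → c ∈ D → ConstsIn D (∀' x a) → ConstsIn D (a [ x ← con c ])
ConstsIn-[←con] {x = x} {a} {c} c∈D consts e h with conIn-[←con] a e x c h
... | inj₁ refl = c∈D
... | inj₂ h′ = consts e h′

-- Closure

InCl-trans : ∀ {C χ ψ γ} → InCl C χ ψ → InCl C ψ γ → InCl C χ γ
InCl-trans h here = h
InCl-trans here atom⊤ = atom⊤
InCl-trans h (∧l p) = ∧l (InCl-trans h p)
InCl-trans h (∧r p) = ∧r (InCl-trans h p)
InCl-trans h (◇in p) = ◇in (InCl-trans h p)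
InCl-trans h (∀in c∈C p) = ∀in c∈C (InCl-trans h p)

InCl-mono : ∀ {C D χ γ} → C ⊆ D → InCl C χ γ → InCl D χ γ
InCl-mono C⊆D here = here
InCl-mono C⊆D atom⊤ = atom⊤
InCl-mono C⊆D (∧l p) = ∧l (InCl-mono C⊆D p)
InCl-mono C⊆D (∧r p) = ∧r (InCl-mono C⊆D p)
InCl-mono C⊆D (◇in p) = ◇in (InCl-mono C⊆D p)
InCl-mono C⊆D (∀in c∈C p) = ∀in (C⊆D c∈C) (InCl-mono C⊆D p)

InCl-Closed : ∀ {C χ γ} → InCl C χ γ → Closed γ → Closed χ
InCl-Closed here closed = closed
InCl-Closed atom⊤ closed z = refl
InCl-Closed (∧l {φ = a} {ψ = b} p) closed = InCl-Closed p (Closed-∧ˡ {a} {b} closed)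
InCl-Closed (∧r {φ = a} {ψ = b} p) closed = InCl-Closed p (Closed-∧ʳ {a} {b} closed)
InCl-Closed (◇in p) closed = InCl-Closed p closed
InCl-Closed (∀in {x = x} {φ = a} {c = c} _ p) closed = InCl-Closed p (Closed-[←con] x a c closed)

InCl-ConstsIn : ∀ {C χ γ} → InCl C χ γ → ConstsIn C γ → ConstsIn C χ
InCl-ConstsIn here consts = consts
InCl-ConstsIn atom⊤ consts c ()
InCl-ConstsIn (∧l p) consts = InCl-ConstsIn p (λ c h → consts c (∨-true⁺ˡ h))
InCl-ConstsIn (∧r p) consts = InCl-ConstsIn p (λ c h → consts c (∨-true⁺ʳ h))
InCl-ConstsIn (◇in p) consts = InCl-ConstsIn p consts
InCl-ConstsIn (∀in {x = x} {φ = a} c∈C p) consts = InCl-ConstsIn p (ConstsIn-[←con] {x = x} {a} c∈C consts)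

InCl-quantifierDepth : ∀ {C χ γ} → InCl C χ γ → quantifierDepth χ ≤ quantifierDepth γ
InCl-quantifierDepth here = ≤-refl
InCl-quantifierDepth atom⊤ = z≤n
InCl-quantifierDepth (∧l {φ = a} {ψ = b} p) =
  ≤-trans (InCl-quantifierDepth p) (m≤m⊔n (quantifierDepth a) (quantifierDepth b))
InCl-quantifierDepth (∧r {φ = a} {ψ = b} p) =
  ≤-trans (InCl-quantifierDepth p) (m≤n⊔m (quantifierDepth a) (quantifierDepth b))
InCl-quantifierDepth (◇in p) = InCl-quantifierDepth p
InCl-quantifierDepth (∀in {x = x} {φ = a} {c = c} _ p) =
  ≤-trans (InCl-quantifierDepth p)
          (≤-trans (≤-reflexive (quantifierDepth-[←] a x (con c))) (n≤1+n (quantifierDepth a)))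

InClSet-mono : ∀ {C D Φ χ} → C ⊆ D → InClSet C Φ χ → InClSet D Φ χ
InClSet-mono C⊆D (γ , γ∈Φ , χ∈Cl) = γ , γ∈Φ , InCl-mono C⊆D χ∈Cl

InClSet-◇ : ∀ {D Φ ψ} → InClSet D Φ (◇ ψ) → InClSet D Φ ψ
InClSet-◇ (γ , γ∈Φ , ◇ψ∈Cl) = γ , γ∈Φ , InCl-trans (◇in here) ◇ψ∈Cl

-- Fuel is needed since the ∀ clause recurses on instances; size γ suffices.
closure : List ℕ → ℕ → Formula → List Formula
closure D zero γ = []
closure D (suc m) ⊤' = ⊤' ∷ []
closure D (suc m) (atom n r us) = atom n r us ∷ ⊤' ∷ []
closure D (suc m) (a ∧' b) = (a ∧' b) ∷ (closure D m a ++ closure D m b)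
closure D (suc m) (◇ a) = ◇ a ∷ closure D m a
closure D (suc m) (∀' x a) = ∀' x a ∷ concat (map (λ c → closure D m (a [ x ← con c ])) D)

closure-sound : ∀ D m γ {χ} → χ ∈ closure D m γ → InCl D χ γ
closure-sound D (suc m) ⊤' (here refl) = here
closure-sound D (suc m) (atom n r us) (here refl) = here
closure-sound D (suc m) (atom n r us) (there (here refl)) = atom⊤
closure-sound D (suc m) (a ∧' b) (here refl) = here
closure-sound D (suc m) (a ∧' b) (there h) with ∈-++⁻ (closure D m a) h
... | inj₁ h′ = ∧l (closure-sound D m a h′)
... | inj₂ h′ = ∧r (closure-sound D m b h′)
closure-sound D (suc m) (◇ a) (here refl) = here
closure-sound D (suc m) (◇ a) (there h) = ◇in (closure-sound D m a h)
closure-sound D (suc m) (∀' x a) (here refl) = here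
closure-sound D (suc m) (∀' x a) (there h)
  with _ , h′ , ∈map ← ∈-concat⁻′ (map (λ c → closure D m (a [ x ← con c ])) D) h
  with c , c∈D , refl ← ∈-map⁻ (λ c → closure D m (a [ x ← con c ])) ∈map
  = ∀in c∈D (closure-sound D m (a [ x ← con c ]) h′)

closure-here : ∀ D m γ → 1 ≤ m → γ ∈ closure D m γ
closure-here D (suc m) ⊤' _ = here refl
closure-here D (suc m) (atom n r us) _ = here refl
closure-here D (suc m) (a ∧' b) _ = here refl
closure-here D (suc m) (◇ a) _ = here refl
closure-here D (suc m) (∀' x a) _ = here refl

closure-complete : ∀ D {χ γ} → InCl D χ γ → ∀ m → size γ ≤ m → χ ∈ closure D m γ
closure-complete D {γ = γ} here m le = closure-here D m γ (≤-trans (1≤size γ) le)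
closure-complete D atom⊤ (suc m) le = there (here refl)
closure-complete D (∧l {φ = a} p) (suc m) (s≤s le) =
  there (∈-++⁺ˡ (closure-complete D p m (m+n≤o⇒m≤o (size a) le)))
closure-complete D (∧r {φ = a} p) (suc m) (s≤s le) =
  there (∈-++⁺ʳ (closure D m a) (closure-complete D p m (m+n≤o⇒n≤o (size a) le)))
closure-complete D (◇in p) (suc m) (s≤s le) = there (closure-complete D p m le)
closure-complete D (∀in {x = x} {φ = a} {c = c} c∈D p) (suc m) (s≤s le) =
  there (∈-concat⁺′ (closure-complete D p m (≤-trans (≤-reflexive (size-[←] a x (con c))) le))
                    (∈-map⁺ (λ c → closure D m (a [ x ← con c ])) c∈D))

closureSet : List ℕ → List Formula → List Formula
closureSet D Φ = concat (map (λ γ → closure D (size γ) γ) Φ)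

closureSet-sound : ∀ D Φ {χ} → χ ∈ closureSet D Φ → InClSet D Φ χ
closureSet-sound D Φ h
  with _ , h′ , ∈map ← ∈-concat⁻′ (map (λ γ → closure D (size γ) γ) Φ) h
  with γ , γ∈Φ , refl ← ∈-map⁻ (λ γ → closure D (size γ) γ) ∈map
  = γ , γ∈Φ , closure-sound D (size γ) γ h′

closureSet-complete : ∀ D Φ {χ} → InClSet D Φ χ → χ ∈ closureSet D Φ
closureSet-complete D Φ (γ , γ∈Φ , p) =
  ∈-concat⁺′ (closure-complete D p (size γ) ≤-refl) (∈-map⁺ (λ γ → closure D (size γ) γ) γ∈Φ)

-- Tree models

Env : Set
Env = ℕ → ℕ

_[_↦_] : Env → ℕ → ℕ → Env
(ρ [ x ↦ d ]) y = if x ≡ᵇ y then d else ρ y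

[↦]-self : ∀ ρ x z → (ρ [ x ↦ ρ x ]) z ≡ ρ z
[↦]-self ρ x z with x ≡ᵇ z in x≟z
... | true = cong ρ (≡ᵇ-true⇒≡ x≟z)
... | false = refl

[↦]-fresh : ∀ {ρ x d a} → freeIn x a ≡ false → ∀ z → freeIn z a ≡ true → ρ z ≡ (ρ [ x ↦ d ]) z
[↦]-fresh {x = x} x∉a z z∈a with x ≡ᵇ z in x≟z
... | false = refl
... | true with refl ← ≡ᵇ-true⇒≡ {x} {z} x≟z = ⊥-elim (true≢false (trans (sym z∈a) x∉a))

-- Variables are interpreted by ρ and constants by ι, both into ℕ; a value v is
-- named by the constant `con v`, so that the facts of a node are ground atoms.
termValue : Env → Env → Term → ℕ
termValue ρ ι (var y) = ρ y
termValue ρ ι (con c) = ι c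

instantiate : ∀ {n} → Env → Env → Vec Term n → Vec Term n
instantiate ρ ι [] = []
instantiate ρ ι (u ∷ us) = con (termValue ρ ι u) ∷ instantiate ρ ι us

instantiate-ground : ∀ {n} ρ ι (us : Vec Term n) → (∀ z → varInTs z us ≡ false) →
  (∀ c → conInTs c us ≡ true → ι c ≡ c) → instantiate ρ ι us ≡ us
instantiate-ground ρ ι [] _ _ = refl
instantiate-ground ρ ι (var y ∷ us) closed _ = ⊥-elim (true≢false (trans (sym (∨-true⁺ˡ (≡ᵇ-refl y))) (closed y)))
instantiate-ground ρ ι (con c ∷ us) closed ι-fix =
  cong₂ _∷_ (cong con (ι-fix c (∨-true⁺ˡ (≡ᵇ-refl c))))
            (instantiate-ground ρ ι us closed (λ c′ e → ι-fix c′ (∨-true⁺ʳ e)))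

data Tree : Set where
  node : List Formula → List Tree → Tree

facts : Tree → List Formula
facts (node fs cs) = fs

children : Tree → List Tree
children (node fs cs) = cs

module Semantics (D : List ℕ) where

  -- ◇ a holds at a node when a holds at a proper descendant, so accessibility is
  -- the transitive closure of the child relation and ◇ ◇ a ⊢ ◇ a is valid.
  mutual
    eval : Tree → Env → Env → Formula → Bool
    eval t ρ ι ⊤' = true
    eval (node fs cs) ρ ι (atom n r us) = does (atom n r (instantiate ρ ι us) ∈ᶠ? fs)
    eval t ρ ι (a ∧' b) = eval t ρ ι a ∧ eval t ρ ι b
    eval (node fs cs) ρ ι (◇ a) = evalBelow cs ρ ι a
    eval t ρ ι (∀' x a) = all (λ d → eval t (ρ [ x ↦ d ]) ι a) D

    evalBelow : List Tree → Env → Env → Formula → Bool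
    evalBelow [] ρ ι a = false
    evalBelow (s ∷ ss) ρ ι a = (eval s ρ ι a ∨ eval s ρ ι (◇ a)) ∨ evalBelow ss ρ ι a

  eval-◇ : ∀ t ρ ι a → eval t ρ ι (◇ a) ≡ evalBelow (children t) ρ ι a
  eval-◇ (node fs cs) ρ ι a = refl

  AtOrBelow : Tree → Env → Env → Formula → Set
  AtOrBelow s ρ ι a = eval s ρ ι a ≡ true ⊎ eval s ρ ι (◇ a) ≡ true

  evalBelow⁻ : ∀ cs ρ ι a → evalBelow cs ρ ι a ≡ true → ∃[ s ] (s ∈ cs × AtOrBelow s ρ ι a)
  evalBelow⁻ (s ∷ ss) ρ ι a e with ∨-true⁻ e
  ... | inj₁ e′ = s , here refl , ∨-true⁻ e′
  ... | inj₂ e′ with s′ , s′∈ss , below ← evalBelow⁻ ss ρ ι a e′ = s′ , there s′∈ss , below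

  evalBelow⁺ : ∀ cs ρ ι a {s} → s ∈ cs → AtOrBelow s ρ ι a → evalBelow cs ρ ι a ≡ true
  evalBelow⁺ (s ∷ ss) ρ ι a (here refl) (inj₁ e) = ∨-true⁺ˡ (∨-true⁺ˡ e)
  evalBelow⁺ (s ∷ ss) ρ ι a (here refl) (inj₂ e) = ∨-true⁺ˡ (∨-true⁺ʳ {eval s ρ ι a} e)
  evalBelow⁺ (_ ∷ ss) ρ ι a (there s∈ss) below = ∨-true⁺ʳ (evalBelow⁺ ss ρ ι a s∈ss below)

  eval-atom⁻ : ∀ t ρ ι n r us → eval t ρ ι (atom n r us) ≡ true → atom n r (instantiate ρ ι us) ∈ facts t
  eval-atom⁻ (node fs cs) ρ ι n r us e = dec-true⁻ (_ ∈ᶠ? fs) e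

  eval-◇⁻ : ∀ t ρ ι a → eval t ρ ι (◇ a) ≡ true → ∃[ s ] (s ∈ children t × AtOrBelow s ρ ι a)
  eval-◇⁻ (node fs cs) ρ ι a = evalBelow⁻ cs ρ ι a

  evalBelow-mono : ∀ ρ ι a ρ′ ι′ b → (∀ s → eval s ρ ι a ≡ true → eval s ρ′ ι′ b ≡ true) →
    ∀ cs → evalBelow cs ρ ι a ≡ true → evalBelow cs ρ′ ι′ b ≡ true
  evalBelow-mono ρ ι a ρ′ ι′ b a⇒b (node fs cs′ ∷ ss) e with ∨-true⁻ e
  ... | inj₂ e′ = ∨-true⁺ʳ (evalBelow-mono ρ ι a ρ′ ι′ b a⇒b ss e′)
  ... | inj₁ e′ with ∨-true⁻ e′
  ...   | inj₁ here-a = ∨-true⁺ˡ (∨-true⁺ˡ (a⇒b (node fs cs′) here-a))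
  ...   | inj₂ below-a = ∨-true⁺ˡ (∨-true⁺ʳ {eval (node fs cs′) ρ′ ι′ b}
                                     (evalBelow-mono ρ ι a ρ′ ι′ b a⇒b cs′ below-a))

  eval-◇-cong : ∀ ρ ι a ρ′ ι′ b → (∀ s → eval s ρ ι a ≡ eval s ρ′ ι′ b) →
    ∀ t → eval t ρ ι (◇ a) ≡ eval t ρ′ ι′ (◇ b)
  eval-◇-cong ρ ι a ρ′ ι′ b a≡b (node fs cs) =
    true-⇔⇒≡ (evalBelow-mono ρ ι a ρ′ ι′ b (λ s e → trans (sym (a≡b s)) e) cs)
             (evalBelow-mono ρ′ ι′ b ρ ι a (λ s e → trans (a≡b s) e) cs)

  instantiate-free-cong : ∀ {n} ρ ρ′ ι (us : Vec Term n) → (∀ z → varInTs z us ≡ true → ρ z ≡ ρ′ z) →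
    instantiate ρ ι us ≡ instantiate ρ′ ι us
  instantiate-free-cong ρ ρ′ ι [] h = refl
  instantiate-free-cong ρ ρ′ ι (var y ∷ us) h =
    cong₂ _∷_ (cong con (h y (∨-true⁺ˡ (≡ᵇ-refl y))))
              (instantiate-free-cong ρ ρ′ ι us (λ z e → h z (∨-true⁺ʳ e)))
  instantiate-free-cong ρ ρ′ ι (con c ∷ us) h = cong (con (ι c) ∷_) (instantiate-free-cong ρ ρ′ ι us h)

  eval-free-cong : ∀ a t ρ ρ′ ι → (∀ z → freeIn z a ≡ true → ρ z ≡ ρ′ z) →
    eval t ρ ι a ≡ eval t ρ′ ι a
  eval-free-cong ⊤' t ρ ρ′ ι h = refl
  eval-free-cong (atom n r us) (node fs cs) ρ ρ′ ι h =
    cong (λ v → does (atom n r v ∈ᶠ? fs)) (instantiate-free-cong ρ ρ′ ι us h)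
  eval-free-cong (a ∧' b) t ρ ρ′ ι h =
    cong₂ _∧_ (eval-free-cong a t ρ ρ′ ι (λ z e → h z (∨-true⁺ˡ e)))
              (eval-free-cong b t ρ ρ′ ι (λ z e → h z (∨-true⁺ʳ e)))
  eval-free-cong (◇ a) t ρ ρ′ ι h = eval-◇-cong ρ ι a ρ′ ι a (λ s → eval-free-cong a s ρ ρ′ ι h) t
  eval-free-cong (∀' x a) t ρ ρ′ ι h = all-cong D λ d → eval-free-cong a t (ρ [ x ↦ d ]) (ρ′ [ x ↦ d ]) ι (agree d)
    where
    agree : ∀ d z → freeIn z a ≡ true → (ρ [ x ↦ d ]) z ≡ (ρ′ [ x ↦ d ]) z
    agree d z e with x ≡ᵇ z in x≟z
    ... | true = refl
    ... | false = h z (∧-true⁺ (cong not (trans (≡ᵇ-sym z x) x≟z)) e)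

  eval-env-cong : ∀ a t ρ ρ′ ι → (∀ z → ρ z ≡ ρ′ z) → eval t ρ ι a ≡ eval t ρ′ ι a
  eval-env-cong a t ρ ρ′ ι h = eval-free-cong a t ρ ρ′ ι (λ z _ → h z)

  instantiate-con-cong : ∀ {n} ρ ι ι′ (us : Vec Term n) → (∀ c → conInTs c us ≡ true → ι c ≡ ι′ c) →
    instantiate ρ ι us ≡ instantiate ρ ι′ us
  instantiate-con-cong ρ ι ι′ [] h = refl
  instantiate-con-cong ρ ι ι′ (var y ∷ us) h = cong (con (ρ y) ∷_) (instantiate-con-cong ρ ι ι′ us h)
  instantiate-con-cong ρ ι ι′ (con c ∷ us) h =
    cong₂ _∷_ (cong con (h c (∨-true⁺ˡ (≡ᵇ-refl c))))
              (instantiate-con-cong ρ ι ι′ us (λ e h′ → h e (∨-true⁺ʳ h′)))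

  eval-con-cong : ∀ a t ρ ι ι′ → (∀ c → conIn c a ≡ true → ι c ≡ ι′ c) →
    eval t ρ ι a ≡ eval t ρ ι′ a
  eval-con-cong ⊤' t ρ ι ι′ h = refl
  eval-con-cong (atom n r us) (node fs cs) ρ ι ι′ h =
    cong (λ v → does (atom n r v ∈ᶠ? fs)) (instantiate-con-cong ρ ι ι′ us h)
  eval-con-cong (a ∧' b) t ρ ι ι′ h =
    cong₂ _∧_ (eval-con-cong a t ρ ι ι′ (λ c e → h c (∨-true⁺ˡ e)))
              (eval-con-cong b t ρ ι ι′ (λ c e → h c (∨-true⁺ʳ e)))
  eval-con-cong (◇ a) t ρ ι ι′ h = eval-◇-cong ρ ι a ρ ι′ a (λ s → eval-con-cong a s ρ ι ι′ h) t
  eval-con-cong (∀' x a) t ρ ι ι′ h = all-cong D λ d → eval-con-cong a t (ρ [ x ↦ d ]) ι ι′ h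

  termValue-[←] : ∀ ρ ι x u v → termValue ρ ι (substT x u v) ≡ termValue (ρ [ x ↦ termValue ρ ι u ]) ι v
  termValue-[←] ρ ι x u (var y) with x ≡ᵇ y
  ... | true = refl
  ... | false = refl
  termValue-[←] ρ ι x u (con c) = refl

  instantiate-[←] : ∀ {n} ρ ι x u (us : Vec Term n) →
    instantiate ρ ι (substTs x u us) ≡ instantiate (ρ [ x ↦ termValue ρ ι u ]) ι us
  instantiate-[←] ρ ι x u [] = refl
  instantiate-[←] ρ ι x u (v ∷ us) = cong₂ _∷_ (cong con (termValue-[←] ρ ι x u v)) (instantiate-[←] ρ ι x u us)

  termValue-[↦]-fresh : ∀ ρ ι y d u → varInT y u ≡ false → termValue (ρ [ y ↦ d ]) ι u ≡ termValue ρ ι u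
  termValue-[↦]-fresh ρ ι y d (var z) e with y ≡ᵇ z
  ... | false = refl
  termValue-[↦]-fresh ρ ι y d (con c) e = refl

  eval-[←] : ∀ a t ρ ι x u → freeFor u x a ≡ true →
    eval t ρ ι (a [ x ← u ]) ≡ eval t (ρ [ x ↦ termValue ρ ι u ]) ι a
  eval-[←] ⊤' t ρ ι x u ff = refl
  eval-[←] (atom n r us) (node fs cs) ρ ι x u ff =
    cong (λ v → does (atom n r v ∈ᶠ? fs)) (instantiate-[←] ρ ι x u us)
  eval-[←] (a ∧' b) t ρ ι x u ff =
    cong₂ _∧_ (eval-[←] a t ρ ι x u (∧-true⁻ˡ ff)) (eval-[←] b t ρ ι x u (∧-true⁻ʳ ff))
  eval-[←] (◇ a) t ρ ι x u ff = eval-◇-cong ρ ι (a [ x ← u ]) _ ι a (λ s → eval-[←] a s ρ ι x u ff) t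
  eval-[←] (∀' y a) t ρ ι x u ff with freeIn x (∀' y a) in x∈
  ... | false = trans (cong (eval t ρ ι) ([←]-fresh (∀' y a) x u x∈))
                      (eval-free-cong (∀' y a) t ρ _ ι ([↦]-fresh {a = ∀' y a} x∈))
  ... | true with x ≡ᵇ y in x≟y
  ...   | true = ⊥-elim (true≢false (sym x∈))
  ...   | false = all-cong D λ d →
          trans (eval-[←] a t (ρ [ y ↦ d ]) ι x u (∧-true⁻ʳ ff))
                (eval-env-cong a t _ _ ι (swap (not-true⇒false (∧-true⁻ˡ ff)) d))
    where
    swap : varInT y u ≡ false → ∀ d z →
      ((ρ [ y ↦ d ]) [ x ↦ termValue (ρ [ y ↦ d ]) ι u ]) z ≡ ((ρ [ x ↦ termValue ρ ι u ]) [ y ↦ d ]) z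
    swap y∉u d z with x ≡ᵇ z in x≟z | y ≡ᵇ z in y≟z
    ... | true | true with refl ← ≡ᵇ-true⇒≡ {x} {z} x≟z | refl ← ≡ᵇ-true⇒≡ {y} {z} y≟z =
      ⊥-elim (true≢false (trans (sym (≡ᵇ-refl x)) x≟y))
    ... | true | false = termValue-[↦]-fresh ρ ι y d u y∉u
    ... | false | true = refl
    ... | false | false = refl

  InDomain : Env → Set
  InDomain ρ = ∀ y → ρ y ∈ D

  [↦]-InDomain : ∀ {ρ} x {d} → InDomain ρ → d ∈ D → InDomain (ρ [ x ↦ d ])
  [↦]-InDomain x ρ∈D d∈D y with x ≡ᵇ y
  ... | true = d∈D
  ... | false = ρ∈D y

  termValue-InDomain : ∀ {ρ ι} u → InDomain ρ → InDomain ι → termValue ρ ι u ∈ D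
  termValue-InDomain (var y) ρ∈D ι∈D = ρ∈D y
  termValue-InDomain (con c) ρ∈D ι∈D = ι∈D c

  evalBelow-◇ : ∀ cs ρ ι a → evalBelow cs ρ ι (◇ a) ≡ true → evalBelow cs ρ ι a ≡ true
  evalBelow-◇ (node fs cs′ ∷ ss) ρ ι a e with ∨-true⁻ e
  ... | inj₂ e′ = ∨-true⁺ʳ (evalBelow-◇ ss ρ ι a e′)
  ... | inj₁ e′ with ∨-true⁻ e′
  ...   | inj₁ here-◇a = ∨-true⁺ˡ (∨-true⁺ʳ {eval (node fs cs′) ρ ι a} here-◇a)
  ...   | inj₂ below-◇a = ∨-true⁺ˡ (∨-true⁺ʳ {eval (node fs cs′) ρ ι a} (evalBelow-◇ cs′ ρ ι a below-◇a))

  evalBelow-∀ : ∀ cs ρ ι x a {d} → d ∈ D → evalBelow cs ρ ι (∀' x a) ≡ true →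
    evalBelow cs (ρ [ x ↦ d ]) ι a ≡ true
  evalBelow-∀ (node fs cs′ ∷ ss) ρ ι x a d∈D e with ∨-true⁻ e
  ... | inj₂ e′ = ∨-true⁺ʳ (evalBelow-∀ ss ρ ι x a d∈D e′)
  ... | inj₁ e′ with ∨-true⁻ e′
  ...   | inj₁ here-∀ = ∨-true⁺ˡ (∨-true⁺ˡ (all-true⁻ _ D here-∀ d∈D))
  ...   | inj₂ below-∀ = ∨-true⁺ˡ (∨-true⁺ʳ {eval (node fs cs′) (ρ [ x ↦ _ ]) ι a}
                                     (evalBelow-∀ cs′ ρ ι x a d∈D below-∀))

  eval-[←fresh-con] : ∀ a t ρ ι x c → conIn c a ≡ false →
    eval t ρ (ι [ c ↦ ρ x ]) (a [ x ← con c ]) ≡ eval t ρ ι a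
  eval-[←fresh-con] a t ρ ι x c c∉a = begin
    eval t ρ ι′ (a [ x ← con c ])             ≡⟨ eval-[←] a t ρ ι′ x (con c) (freeFor-con a x c) ⟩
    eval t (ρ [ x ↦ ι′ c ]) ι′ a             ≡⟨ cong (λ v → eval t (ρ [ x ↦ v ]) ι′ a) ι′c≡ρx ⟩
    eval t (ρ [ x ↦ ρ x ]) ι′ a              ≡⟨ eval-env-cong a t _ ρ ι′ ([↦]-self ρ x) ⟩
    eval t ρ ι′ a                            ≡⟨ eval-con-cong a t ρ ι′ ι (λ e e∈a → sym ([↦]-fresh′ e e∈a)) ⟩
    eval t ρ ι a                             ∎
    where
    open ≡-Reasoning
    ι′ = ι [ c ↦ ρ x ]
    ι′c≡ρx : ι′ c ≡ ρ x
    ι′c≡ρx rewrite ≡ᵇ-refl c = refl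
    [↦]-fresh′ : ∀ e → conIn e a ≡ true → ι e ≡ ι′ e
    [↦]-fresh′ e e∈a with c ≡ᵇ e in c≟e
    ... | false = refl
    ... | true with refl ← ≡ᵇ-true⇒≡ {c} {e} c≟e = ⊥-elim (true≢false (trans (sym e∈a) c∉a))

  sound : ∀ {φ ψ} → φ ⊢ ψ → ∀ t ρ ι → InDomain ρ → InDomain ι → eval t ρ ι φ ≡ true → eval t ρ ι ψ ≡ true
  sound ax⊤ t ρ ι ρ∈D ι∈D e = refl
  sound ax-id t ρ ι ρ∈D ι∈D e = e
  sound ax-∧l t ρ ι ρ∈D ι∈D e = ∧-true⁻ˡ e
  sound (ax-∧r {φ}) t ρ ι ρ∈D ι∈D e = ∧-true⁻ʳ {eval t ρ ι φ} e
  sound (ax-◇◇ {φ}) t ρ ι ρ∈D ι∈D e =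
    trans (eval-◇ t ρ ι φ) (evalBelow-◇ (children t) ρ ι φ (trans (sym (eval-◇ t ρ ι (◇ φ))) e))
  sound (ax-◇∀ {x} {φ}) t ρ ι ρ∈D ι∈D e = all-true⁺ _ D λ d∈D →
    trans (eval-◇ t _ ι φ) (evalBelow-∀ (children t) ρ ι x φ d∈D (trans (sym (eval-◇ t ρ ι (∀' x φ))) e))
  sound (r-∧ d₁ d₂) t ρ ι ρ∈D ι∈D e = ∧-true⁺ (sound d₁ t ρ ι ρ∈D ι∈D e) (sound d₂ t ρ ι ρ∈D ι∈D e)
  sound (r-cut d₁ d₂) t ρ ι ρ∈D ι∈D e = sound d₂ t ρ ι ρ∈D ι∈D (sound d₁ t ρ ι ρ∈D ι∈D e)
  sound (r-◇ {φ} {ψ} d) t ρ ι ρ∈D ι∈D e =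
    trans (eval-◇ t ρ ι ψ)
      (evalBelow-mono ρ ι φ ρ ι ψ (λ s → sound d s ρ ι ρ∈D ι∈D) (children t) (trans (sym (eval-◇ t ρ ι φ)) e))
  sound (r-∀R {φ} {x = x} x∉φ d) t ρ ι ρ∈D ι∈D e = all-true⁺ _ D λ {v} v∈D →
    sound d t (ρ [ x ↦ v ]) ι ([↦]-InDomain x ρ∈D v∈D) ι∈D
      (trans (sym (eval-free-cong φ t ρ _ ι ([↦]-fresh {a = φ} x∉φ))) e)
  sound (r-∀L {φ} {x = x} {u} ff d) t ρ ι ρ∈D ι∈D e =
    sound d t ρ ι ρ∈D ι∈D (trans (eval-[←] φ t ρ ι x u ff) (all-true⁻ _ D e (termValue-InDomain u ρ∈D ι∈D)))
  sound (r-sub {φ} {ψ} {x} {u} ffφ ffψ d) t ρ ι ρ∈D ι∈D e =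
    trans (eval-[←] ψ t ρ ι x u ffψ)
      (sound d t _ ι ([↦]-InDomain x ρ∈D (termValue-InDomain u ρ∈D ι∈D)) ι∈D
        (trans (sym (eval-[←] φ t ρ ι x u ffφ)) e))
  sound (r-con {φ} {ψ} {x} {c} c∉φ c∉ψ d) t ρ ι ρ∈D ι∈D e =
    trans (sym (eval-[←fresh-con] ψ t ρ ι x c c∉ψ))
      (sound d t ρ _ ρ∈D ([↦]-InDomain c ι∈D (ρ∈D x)) (trans (eval-[←fresh-con] φ t ρ ι x c c∉φ) e))

-- Canonical trees

merge : Tree → Tree → Tree
merge (node fs₁ cs₁) (node fs₂ cs₂) = node (fs₁ ++ fs₂) (cs₁ ++ cs₂)

mergeAll : List Tree → Tree
mergeAll [] = node [] []
mergeAll (t ∷ ts) = merge t (mergeAll ts)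

_≼_ : Tree → Tree → Set
t ≼ t′ = facts t ⊆ facts t′ × children t ⊆ children t′

≼-trans : ∀ t₁ t₂ t₃ → t₁ ≼ t₂ → t₂ ≼ t₃ → t₁ ≼ t₃
≼-trans _ _ _ (fs₁₂ , cs₁₂) (fs₂₃ , cs₂₃) = (λ m → fs₂₃ (fs₁₂ m)) , (λ m → cs₂₃ (cs₁₂ m))

≼-mergeˡ : ∀ t t′ → t ≼ merge t t′
≼-mergeˡ (node fs₁ cs₁) (node fs₂ cs₂) = ∈-++⁺ˡ , ∈-++⁺ˡ

≼-mergeʳ : ∀ t t′ → t′ ≼ merge t t′
≼-mergeʳ (node fs₁ cs₁) (node fs₂ cs₂) = ∈-++⁺ʳ fs₁ , ∈-++⁺ʳ cs₁

≼-mergeAll : ∀ {t} ts → t ∈ ts → t ≼ mergeAll ts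
≼-mergeAll (t ∷ ts) (here refl) = ≼-mergeˡ t (mergeAll ts)
≼-mergeAll {s} (t ∷ ts) (there m) =
  ≼-trans s (mergeAll ts) (mergeAll (t ∷ ts)) (≼-mergeAll ts m) (≼-mergeʳ t (mergeAll ts))

facts-merge⁻ : ∀ t t′ {f} → f ∈ facts (merge t t′) → f ∈ facts t ⊎ f ∈ facts t′
facts-merge⁻ (node fs₁ cs₁) (node fs₂ cs₂) m = ∈-++⁻ fs₁ m

children-merge⁻ : ∀ t t′ {s} → s ∈ children (merge t t′) → s ∈ children t ⊎ s ∈ children t′
children-merge⁻ (node fs₁ cs₁) (node fs₂ cs₂) m = ∈-++⁻ cs₁ m

facts-mergeAll⁻ : ∀ ts {f} → f ∈ facts (mergeAll ts) → ∃[ t ] (t ∈ ts × f ∈ facts t)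
facts-mergeAll⁻ (t ∷ ts) m with facts-merge⁻ t (mergeAll ts) m
... | inj₁ m′ = t , here refl , m′
... | inj₂ m′ with t′ , t′∈ts , m″ ← facts-mergeAll⁻ ts m′ = t′ , there t′∈ts , m″

children-mergeAll⁻ : ∀ ts {s} → s ∈ children (mergeAll ts) → ∃[ t ] (t ∈ ts × s ∈ children t)
children-mergeAll⁻ (t ∷ ts) m with children-merge⁻ t (mergeAll ts) m
... | inj₁ m′ = t , here refl , m′
... | inj₂ m′ with t′ , t′∈ts , m″ ← children-mergeAll⁻ ts m′ = t′ , there t′∈ts , m″

module Canonical (D : List ℕ) where
  open Semantics D

  -- m is fuel (size α suffices) and k a height budget: a ◇ beyond depth k gets no child.
  canonical : ℕ → ℕ → Formula → Tree
  canonical zero k α = node [] []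
  canonical (suc m) k ⊤' = node [] []
  canonical (suc m) k (atom n r us) = node (atom n r us ∷ []) []
  canonical (suc m) k (a ∧' b) = merge (canonical m k a) (canonical m k b)
  canonical (suc m) zero (◇ a) = node [] []
  canonical (suc m) (suc k) (◇ a) = node [] (canonical m k a ∷ [])
  canonical (suc m) k (∀' x a) = mergeAll (map (λ d → canonical m k (a [ x ← con d ])) D)

  instanceTrees : ℕ → ℕ → ℕ → Formula → List Tree
  instanceTrees m k x a = map (λ d → canonical m k (a [ x ← con d ])) D

  instanceTrees⁻ : ∀ m k x a {t} → t ∈ instanceTrees m k x a → ∃[ d ] (d ∈ D × t ≡ canonical m k (a [ x ← con d ]))
  instanceTrees⁻ m k x a t∈ with d , d∈D , refl ← ∈-map⁻ (λ d → canonical m k (a [ x ← con d ])) t∈ =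
    d , d∈D , refl

  eval-mono : ∀ a {t t′} ρ ι → t ≼ t′ → eval t ρ ι a ≡ true → eval t′ ρ ι a ≡ true
  eval-mono ⊤' ρ ι t≼t′ e = refl
  eval-mono (atom n r us) {t} {node fs′ cs′} ρ ι (fs⊆ , _) e =
    dec-true (_ ∈ᶠ? fs′) (fs⊆ (eval-atom⁻ t ρ ι n r us e))
  eval-mono (a ∧' b) {t} ρ ι t≼t′ e =
    ∧-true⁺ (eval-mono a ρ ι t≼t′ (∧-true⁻ˡ e)) (eval-mono b ρ ι t≼t′ (∧-true⁻ʳ {eval t ρ ι a} e))
  eval-mono (◇ a) {node fs cs} {node fs′ cs′} ρ ι (_ , cs⊆) e
    with s , s∈cs , below ← evalBelow⁻ cs ρ ι a e = evalBelow⁺ cs′ ρ ι a (cs⊆ s∈cs) below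
  eval-mono (∀' x a) ρ ι t≼t′ e = all-true⁺ _ D λ d∈D → eval-mono a _ ι t≼t′ (all-true⁻ _ D e d∈D)

  children-canonical-zero : ∀ m α s → s ∉ children (canonical m zero α)
  children-canonical-zero (suc m) (a ∧' b) s s∈
    with children-merge⁻ (canonical m zero a) (canonical m zero b) s∈
  ... | inj₁ s∈a = children-canonical-zero m a s s∈a
  ... | inj₂ s∈b = children-canonical-zero m b s s∈b
  children-canonical-zero (suc m) (∀' x a) s s∈
    with t , t∈ , s∈t ← children-mergeAll⁻ (instanceTrees m zero x a) s∈
    with d , _ , refl ← instanceTrees⁻ m zero x a t∈
    = children-canonical-zero m (a [ x ← con d ]) s s∈t

  children-canonical-suc : ∀ m k α s → s ∈ children (canonical m (suc k) α) →
    ∃[ m′ ] ∃[ β ] (s ≡ canonical m′ k β)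
  children-canonical-suc (suc m) k (a ∧' b) s s∈
    with children-merge⁻ (canonical m (suc k) a) (canonical m (suc k) b) s∈
  ... | inj₁ s∈a = children-canonical-suc m k a s s∈a
  ... | inj₂ s∈b = children-canonical-suc m k b s s∈b
  children-canonical-suc (suc m) k (◇ a) s (here refl) = m , a , refl
  children-canonical-suc (suc m) k (∀' x a) s s∈
    with t , t∈ , s∈t ← children-mergeAll⁻ (instanceTrees m (suc k) x a) s∈
    with d , _ , refl ← instanceTrees⁻ m (suc k) x a t∈
    = children-canonical-suc m k (a [ x ← con d ]) s s∈t

  -- D must be inhabited: over an empty domain every ∀ is true regardless of depth.
  md-bound : ∀ {d₀} → d₀ ∈ D → ∀ a k m α ρ ι → eval (canonical m k α) ρ ι a ≡ true → md a ≤ k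
  md-bound d₀∈D ⊤' k m α ρ ι e = z≤n
  md-bound d₀∈D (atom n r us) k m α ρ ι e = z≤n
  md-bound d₀∈D (a ∧' b) k m α ρ ι e =
    ⊔-lub (md-bound d₀∈D a k m α ρ ι (∧-true⁻ˡ e))
          (md-bound d₀∈D b k m α ρ ι (∧-true⁻ʳ {eval (canonical m k α) ρ ι a} e))
  md-bound d₀∈D (∀' x a) k m α ρ ι e = md-bound d₀∈D a k m α _ ι (all-true⁻ _ D e d₀∈D)
  md-bound d₀∈D (◇ a) zero m α ρ ι e with s , s∈ , _ ← eval-◇⁻ (canonical m zero α) ρ ι a e =
    ⊥-elim (children-canonical-zero m α s s∈)
  md-bound d₀∈D (◇ a) (suc k) m α ρ ι e with eval-◇⁻ (canonical m (suc k) α) ρ ι a e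
  ... | s , s∈ , below with children-canonical-suc m k α s s∈
  ...   | m′ , β , refl with below
  ...     | inj₁ a-at-s = s≤s (md-bound d₀∈D a k m′ β ρ ι a-at-s)
  ...     | inj₂ ◇a-at-s = m≤n⇒m≤1+n (md-bound d₀∈D (◇ a) k m′ β ρ ι ◇a-at-s)

  facts-derivable : ∀ m k α {f} → f ∈ facts (canonical m k α) → α ⊢ f
  facts-derivable (suc m) k (atom n r us) (here refl) = ax-id
  facts-derivable (suc m) k (a ∧' b) f∈ with facts-merge⁻ (canonical m k a) (canonical m k b) f∈
  ... | inj₁ f∈a = r-cut ax-∧l (facts-derivable m k a f∈a)
  ... | inj₂ f∈b = r-cut ax-∧r (facts-derivable m k b f∈b)
  facts-derivable (suc m) zero (◇ a) ()
  facts-derivable (suc m) (suc k) (◇ a) ()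
  facts-derivable (suc m) k (∀' x a) f∈
    with t , t∈ , f∈t ← facts-mergeAll⁻ (instanceTrees m k x a) f∈
    with d , _ , refl ← instanceTrees⁻ m k x a t∈
    = r-∀L (freeFor-con a x d) (facts-derivable m k (a [ x ← con d ]) f∈t)

  canonical-satisfies : ∀ m k α ρ ι → size α ≤ m → md α ≤ k → Closed α → ConstsIn D α →
    (∀ {d} → d ∈ D → ι d ≡ d) → eval (canonical m k α) ρ ι α ≡ true
  canonical-satisfies (suc m) k ⊤' ρ ι _ _ _ _ _ = refl
  canonical-satisfies (suc m) k (atom n r us) ρ ι _ _ closed consts ι-fix =
    dec-true (_ ∈ᶠ? (atom n r us ∷ []))
      (here (cong (atom n r) (instantiate-ground ρ ι us closed (λ c e → ι-fix (consts c e)))))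
  canonical-satisfies (suc m) k (a ∧' b) ρ ι (s≤s size≤) md≤ closed consts ι-fix =
    ∧-true⁺ (eval-mono a ρ ι (≼-mergeˡ (canonical m k a) (canonical m k b))
              (canonical-satisfies m k a ρ ι (m+n≤o⇒m≤o (size a) size≤) (m⊔n≤o⇒m≤o (md a) (md b) md≤)
                 (Closed-∧ˡ {a} {b} closed) (λ c e → consts c (∨-true⁺ˡ e)) ι-fix))
            (eval-mono b ρ ι (≼-mergeʳ (canonical m k a) (canonical m k b))
              (canonical-satisfies m k b ρ ι (m+n≤o⇒n≤o (size a) size≤) (m⊔n≤o⇒n≤o (md a) (md b) md≤)
                 (Closed-∧ʳ {a} {b} closed) (λ c e → consts c (∨-true⁺ʳ e)) ι-fix))
  canonical-satisfies (suc m) (suc k) (◇ a) ρ ι (s≤s size≤) (s≤s md≤) closed consts ι-fix =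
    ∨-true⁺ˡ (∨-true⁺ˡ (canonical-satisfies m k a ρ ι size≤ md≤ closed consts ι-fix))
  canonical-satisfies (suc m) k (∀' x a) ρ ι (s≤s size≤) md≤ closed consts ι-fix = all-true⁺ _ D λ {d} d∈D →
    let a[d] = a [ x ← con d ] in
    eval-mono a (ρ [ x ↦ d ]) ι (≼-mergeAll (instanceTrees m k x a) (∈-map⁺ _ d∈D))
      (begin
        eval (canonical m k a[d]) (ρ [ x ↦ d ]) ι a         ≡⟨ cong (λ v → eval _ (ρ [ x ↦ v ]) ι a) (sym (ι-fix d∈D)) ⟩
        eval (canonical m k a[d]) (ρ [ x ↦ ι d ]) ι a       ≡⟨ sym (eval-[←] a _ ρ ι x (con d) (freeFor-con a x d)) ⟩
        eval (canonical m k a[d]) ρ ι a[d]                 ≡⟨ canonical-satisfies m k a[d] ρ ι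
                                                                 (≤-trans (≤-reflexive (size-[←] a x (con d))) size≤)
                                                                 (≤-trans (≤-reflexive (md-[←] a x (con d))) md≤)
                                                                 (Closed-[←con] x a d closed)
                                                                 (ConstsIn-[←con] {x = x} {a} d∈D consts) ι-fix ⟩
        true                                                ∎)
    where open ≡-Reasoning

-- Truth lemma

pigeonhole : ∀ M n (W : List ℕ) → length W < n → ∃[ i ] (i < n × M + i ∉ W)
pigeonhole M (suc n) W |W|<1+n with M + n ∈? W
... | no M+n∉W = n , n<1+n n , M+n∉W
... | yes M+n∈W = widen (pigeonhole M n W′ (<-≤-trans shorter (≤-pred |W|<1+n)))
  where
  W′ = filter (λ y → ¬? (y ≟ M + n)) W
  shorter : length W′ < length W
  shorter = filter-notAll (λ y → ¬? (y ≟ M + n)) W (Any.map (λ { refl y≢y → y≢y refl }) M+n∈W)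
  widen : ∃[ i ] (i < n × M + i ∉ W′) → ∃[ i ] (i < suc n × M + i ∉ W)
  widen (i , i<n , M+i∉W′) = i , m≤n⇒m≤1+n i<n , λ M+i∈W →
    M+i∉W′ (∈-filter⁺ (λ y → ¬? (y ≟ M + n)) M+i∈W (λ eq → <⇒≢ i<n (+-cancelˡ-≡ M i n eq)))

module TruthLemma (C : List ℕ) (Q : ℕ) where

  -- Each side of the truth lemma instantiates at most Q quantifiers, so one of the
  -- 2Q + 1 fresh constants M + i is always unused.

  M N : ℕ
  M = max 0 (map suc C)
  N = suc (Q + Q)

  D : List ℕ
  D = C ++ applyUpTo (M +_) N

  C⊆D : C ⊆ D
  C⊆D = ∈-++⁺ˡ

  fresh∈D : ∀ {i} → i < N → M + i ∈ D
  fresh∈D i<N = ∈-++⁺ʳ C (∈-applyUpTo⁺ (M +_) i<N)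

  fresh∉C : ∀ i {c} → c ∈ C → c ≢ M + i
  fresh∉C i {c} c∈C = <⇒≢ (<-≤-trans c<M (m≤m+n M i))
    where
    c<M : c < M
    c<M = v<max⁺ 0 (map suc C) (inj₂ (Any.map (λ { refl → n<1+n c }) (∈-map⁺ suc c∈C)))

  d₀ : ℕ
  d₀ = M + 0

  d₀∈D : d₀ ∈ D
  d₀∈D = fresh∈D (s≤s z≤n)

  open Semantics D
  open Canonical D

  ρ₀ : Env
  ρ₀ _ = d₀

  -- Constants outside D are junk, sent to d₀ so that ι₀ ranges over D.
  ι₀ : Env
  ι₀ c with c ∈? D
  ... | yes _ = c
  ... | no _ = d₀

  ι₀-fix : ∀ {d} → d ∈ D → ι₀ d ≡ d
  ι₀-fix {d} d∈D with d ∈? D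
  ... | yes _ = refl
  ... | no d∉D = ⊥-elim (d∉D d∈D)

  ι₀-InDomain : InDomain ι₀
  ι₀-InDomain c with c ∈? D
  ... | yes c∈D = c∈D
  ... | no _ = d₀∈D

  ρ₀-InDomain : InDomain ρ₀
  ρ₀-InDomain _ = d₀∈D

  -- β arises from a formula with constants in C and quantifier depth at most Q
  -- by instantiating length U quantifiers with the constants U.
  Tracked : List ℕ → Formula → Set
  Tracked U β = ConstsIn (C ++ U) β × length U + quantifierDepth β ≤ Q

  Tracked-∧ˡ : ∀ {U} a b → Tracked U (a ∧' b) → Tracked U a
  Tracked-∧ˡ {U} a b (consts , depth) =
    (λ c e → consts c (∨-true⁺ˡ e)) ,
    ≤-trans (+-mono-≤ (≤-refl {length U}) (m≤m⊔n (quantifierDepth a) (quantifierDepth b))) depth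

  Tracked-∧ʳ : ∀ {U} a b → Tracked U (a ∧' b) → Tracked U b
  Tracked-∧ʳ {U} a b (consts , depth) =
    (λ c e → consts c (∨-true⁺ʳ e)) ,
    ≤-trans (+-mono-≤ (≤-refl {length U}) (m≤n⊔m (quantifierDepth a) (quantifierDepth b))) depth

  Tracked-[←con] : ∀ {U} x a d → Tracked U (∀' x a) → Tracked (d ∷ U) (a [ x ← con d ])
  Tracked-[←con] {U} x a d (consts , depth) =
    ConstsIn-[←con] {x = x} {a} (∈-++⁺ʳ C (here refl)) (λ e e∈a → widen (consts e e∈a)) ,
    subst (λ q → suc (length U + q) ≤ Q) (sym (quantifierDepth-[←] a x (con d)))
          (subst (_≤ Q) (+-suc (length U) (quantifierDepth a)) depth)
    where
    widen : (C ++ U) ⊆ (C ++ d ∷ U)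
    widen e∈ with ∈-++⁻ C e∈
    ... | inj₁ e∈C = ∈-++⁺ˡ e∈C
    ... | inj₂ e∈U = ∈-++⁺ʳ C (there e∈U)

  Tracked-fresh : ∀ {U} β i → Tracked U β → M + i ∉ U → conIn (M + i) β ≡ false
  Tracked-fresh {U} β i (consts , _) fresh∉U with conIn (M + i) β in e
  ... | false = refl
  ... | true with ∈-++⁻ C (consts (M + i) e)
  ...   | inj₁ fresh∈C = ⊥-elim (fresh∉C i fresh∈C refl)
  ...   | inj₂ fresh∈U = ⊥-elim (fresh∉U fresh∈U)

  fresh-for : ∀ {U V α β} → Tracked U α → Tracked V β →
    ∃[ d ] (d ∈ D × conIn d α ≡ false × conIn d β ≡ false)
  fresh-for {U} {V} {α} {β} tα tβ = pick (pigeonhole M N (U ++ V) |UV|<N)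
    where
    |UV|<N : length (U ++ V) < N
    |UV|<N = s≤s (subst (_≤ Q + Q) (sym (length-++ U))
                   (+-mono-≤ (m+n≤o⇒m≤o (length U) (proj₂ tα)) (m+n≤o⇒m≤o (length V) (proj₂ tβ))))
    pick : ∃[ i ] (i < N × M + i ∉ U ++ V) → ∃[ d ] (d ∈ D × conIn d α ≡ false × conIn d β ≡ false)
    pick (i , i<N , fresh∉UV) =
      M + i , fresh∈D i<N ,
      Tracked-fresh α i tα (λ m → fresh∉UV (∈-++⁺ˡ m)) , Tracked-fresh β i tβ (λ m → fresh∉UV (∈-++⁺ʳ U m))

  child-derivable : ∀ m k α {U s} → Closed α → Tracked U α → s ∈ children (canonical m (suc k) α) →
    ∃[ m′ ] ∃[ β ] ∃[ U′ ] (s ≡ canonical m′ k β × Closed β × Tracked U′ β × α ⊢ ◇ β)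
  child-derivable (suc m) k (a ∧' b) closed tracked s∈
    with children-merge⁻ (canonical m (suc k) a) (canonical m (suc k) b) s∈
  ... | inj₁ s∈a
    with m′ , β , U′ , eq , cβ , tβ , a⊢◇β ←
           child-derivable m k a (Closed-∧ˡ {a} {b} closed) (Tracked-∧ˡ a b tracked) s∈a
    = m′ , β , U′ , eq , cβ , tβ , r-cut ax-∧l a⊢◇β
  ... | inj₂ s∈b
    with m′ , β , U′ , eq , cβ , tβ , b⊢◇β ←
           child-derivable m k b (Closed-∧ʳ {a} {b} closed) (Tracked-∧ʳ a b tracked) s∈b
    = m′ , β , U′ , eq , cβ , tβ , r-cut ax-∧r b⊢◇β
  child-derivable (suc m) k (◇ a) {U} closed tracked (here refl) = m , a , U , refl , closed , tracked , ax-id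
  child-derivable (suc m) k (∀' x a) closed tracked s∈
    with t , t∈ , s∈t ← children-mergeAll⁻ (instanceTrees m (suc k) x a) s∈
    with d , _ , refl ← instanceTrees⁻ m (suc k) x a t∈
    with m′ , β , U′ , eq , cβ , tβ , a[d]⊢◇β ←
           child-derivable m k (a [ x ← con d ]) (Closed-[←con] x a d closed) (Tracked-[←con] x a d tracked) s∈t
    = m′ , β , U′ , eq , cβ , tβ , r-∀L (freeFor-con a x d) a[d]⊢◇β

  truth : ∀ k n m α χ {U V} → Closed α → Tracked U α → Closed χ → Tracked V χ → ConstsIn D χ →
    size χ ≤ n → eval (canonical m k α) ρ₀ ι₀ χ ≡ true → α ⊢ χ
  truth k (suc n) m α ⊤' _ _ _ _ _ _ _ = ax⊤
  truth k (suc n) m α (atom r s us) _ _ cχ _ dχ _ e =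
    facts-derivable m k α
      (subst (_∈ facts (canonical m k α))
             (cong (atom r s) (instantiate-ground ρ₀ ι₀ us cχ (λ c e → ι₀-fix (dχ c e))))
             (eval-atom⁻ (canonical m k α) ρ₀ ι₀ r s us e))
  truth k (suc n) m α (a ∧' b) cα tα cχ tχ dχ (s≤s size≤) e =
    r-∧ (truth k n m α a cα tα (Closed-∧ˡ {a} {b} cχ) (Tracked-∧ˡ a b tχ) (λ c e → dχ c (∨-true⁺ˡ e))
               (m+n≤o⇒m≤o (size a) size≤) (∧-true⁻ˡ e))
        (truth k n m α b cα tα (Closed-∧ʳ {a} {b} cχ) (Tracked-∧ʳ a b tχ) (λ c e → dχ c (∨-true⁺ʳ e))
               (m+n≤o⇒n≤o (size a) size≤) (∧-true⁻ʳ {eval (canonical m k α) ρ₀ ι₀ a} e))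
  truth zero (suc n) m α (◇ a) _ _ _ _ _ _ e with s , s∈ , _ ← eval-◇⁻ (canonical m zero α) ρ₀ ι₀ a e =
    ⊥-elim (children-canonical-zero m α s s∈)
  truth (suc k) (suc n) m α (◇ a) cα tα cχ tχ dχ (s≤s size≤) e with eval-◇⁻ (canonical m (suc k) α) ρ₀ ι₀ a e
  ... | s , s∈ , below with child-derivable m k α cα tα s∈
  ...   | m′ , β , U′ , refl , cβ , tβ , α⊢◇β with below
  ...     | inj₁ a-at-s = r-cut α⊢◇β (r-◇ (truth k n m′ β a cβ tβ cχ tχ dχ size≤ a-at-s))
  ...     | inj₂ ◇a-at-s =
    r-cut α⊢◇β (r-cut (r-◇ (truth k (suc n) m′ β (◇ a) cβ tβ cχ tχ dχ (s≤s size≤) ◇a-at-s)) ax-◇◇)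
  truth k (suc n) m α (∀' x a) cα tα cχ tχ dχ (s≤s size≤) e =
    r-∀R (cα x) (via-fresh (fresh-for {α = α} {β = ∀' x a} tα tχ))
    where
    -- α is closed, so for d occurring in neither α nor a, r-con reduces α ⊢ a to α ⊢ a[x ← d].
    via-fresh : ∃[ d ] (d ∈ D × conIn d α ≡ false × conIn d a ≡ false) → α ⊢ a
    via-fresh (d , d∈D , d∉α , d∉a) =
      r-con {α} {a} {x} {d} d∉α d∉a (subst (_⊢ a [ x ← con d ]) (sym ([←]-fresh α x (con d) (cα x))) α⊢a[d])
      where
      a[d]-true : eval (canonical m k α) ρ₀ ι₀ (a [ x ← con d ]) ≡ true
      a[d]-true = trans (eval-[←] a _ ρ₀ ι₀ x (con d) (freeFor-con a x d))
                        (trans (cong (λ v → eval _ (ρ₀ [ x ↦ v ]) ι₀ a) (ι₀-fix d∈D)) (all-true⁻ _ D e d∈D))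
      α⊢a[d] : α ⊢ a [ x ← con d ]
      α⊢a[d] = truth k n m α (a [ x ← con d ]) cα tα (Closed-[←con] x a d cχ) (Tracked-[←con] x a d tχ)
                     (ConstsIn-[←con] {x = x} {a} d∈D dχ) (≤-trans (≤-reflexive (size-[←] a x (con d))) size≤)
                     a[d]-true

-- The successor pair

md≤mdSet : ∀ {xs x} → x ∈ xs → md x ≤ mdSet xs
md≤mdSet {x ∷ xs} (here refl) = m≤m⊔n (md x) (mdSet xs)
md≤mdSet {y ∷ xs} (there x∈xs) = ≤-trans (md≤mdSet x∈xs) (m≤n⊔m (md y) (mdSet xs))

mdSet-lub : ∀ xs {b} → (∀ {x} → x ∈ xs → md x ≤ b) → mdSet xs ≤ b
mdSet-lub [] h = z≤n
mdSet-lub (x ∷ xs) h = ⊔-lub (h (here refl)) (mdSet-lub xs (λ m → h (there m)))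

totalQuantifierDepth : List Formula → ℕ
totalQuantifierDepth = foldr (λ γ n → quantifierDepth γ + n) 0

quantifierDepth≤total : ∀ {Φ γ} → γ ∈ Φ → quantifierDepth γ ≤ totalQuantifierDepth Φ
quantifierDepth≤total {γ ∷ Φ} (here refl) = m≤m+n (quantifierDepth γ) (totalQuantifierDepth Φ)
quantifierDepth≤total {γ′ ∷ Φ} (there γ∈Φ) = ≤-trans (quantifierDepth≤total γ∈Φ) (m≤n+m _ (quantifierDepth γ′))

∈⇒⊢s : ∀ {Γ χ} → χ ∈ Γ → Γ ⊢s χ
∈⇒⊢s {χ = χ} χ∈Γ = χ , [] , χ∈Γ , (λ ()) , ax-id

module Successor (C : List ℕ) (Φ : List Formula) (Φ-closed : ∀ {γ} → γ ∈ Φ → Closed γ × ConstsIn C γ)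
                 (p : Pair) (p-inside : InsideCl C Φ p) (p-consistent : Consistent p)
                 (φ : Formula) (◇φ∈p : ◇ φ ∈ pos p) where

  open TruthLemma C (totalQuantifierDepth Φ)
  open Semantics D
  open Canonical D

  InClSet-C-invariants : ∀ {χ} → InClSet C Φ χ → Closed χ × ConstsIn C χ × Tracked [] χ
  InClSet-C-invariants (γ , γ∈Φ , χ∈Cl) =
    InCl-Closed χ∈Cl (proj₁ (Φ-closed γ∈Φ)) , consts ,
    (λ c e → ∈-++⁺ˡ (consts c e)) , ≤-trans (InCl-quantifierDepth χ∈Cl) (quantifierDepth≤total γ∈Φ)
    where consts = InCl-ConstsIn χ∈Cl (proj₂ (Φ-closed γ∈Φ))

  φ∈Cl : InClSet C Φ φ
  φ∈Cl = InClSet-◇ (proj₁ p-inside ◇φ∈p)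

  root : Tree
  root = canonical (size φ) (md φ) φ

  holds : Formula → Bool
  holds χ = eval root ρ₀ ι₀ χ

  holds-φ : holds φ ≡ true
  holds-φ with closed , consts , _ ← InClSet-C-invariants φ∈Cl =
    canonical-satisfies (size φ) (md φ) φ ρ₀ ι₀ ≤-refl ≤-refl closed (λ c e → C⊆D (consts c e)) ι₀-fix

  holds⇒derivable : ∀ {χ} → InClSet C Φ χ → holds χ ≡ true → φ ⊢ χ
  holds⇒derivable χ∈Cl e
    with cφ , _ , tφ ← InClSet-C-invariants φ∈Cl | cχ , consts , tχ ← InClSet-C-invariants χ∈Cl =
    truth (md φ) (size _) (size φ) φ _ cφ tφ cχ tχ (λ c e → C⊆D (consts c e)) ≤-refl e

  holds-md : ∀ χ → holds χ ≡ true → md χ ≤ md φ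
  holds-md χ = md-bound d₀∈D χ (md φ) (size φ) φ ρ₀ ι₀

  q : Pair
  q = ⟨ filter (λ χ → holds χ ≟ᵇ true) (closureSet D Φ) , filter (λ χ → holds χ ≟ᵇ false) (closureSet D Φ) ⟩

  pos-q⁻ : ∀ {χ} → χ ∈ pos q → χ ∈ closureSet D Φ × holds χ ≡ true
  pos-q⁻ = ∈-filter⁻ (λ χ → holds χ ≟ᵇ true)

  neg-q⁻ : ∀ {χ} → χ ∈ neg q → χ ∈ closureSet D Φ × holds χ ≡ false
  neg-q⁻ = ∈-filter⁻ (λ χ → holds χ ≟ᵇ false)

  pos-q⁺ : ∀ {χ} → InClSet D Φ χ → holds χ ≡ true → χ ∈ pos q
  pos-q⁺ χ∈Cl = ∈-filter⁺ (λ χ → holds χ ≟ᵇ true) (closureSet-complete D Φ χ∈Cl)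

  neg-q⁺ : ∀ {χ} → InClSet D Φ χ → holds χ ≡ false → χ ∈ neg q
  neg-q⁺ χ∈Cl = ∈-filter⁺ (λ χ → holds χ ≟ᵇ false) (closureSet-complete D Φ χ∈Cl)

  holds-conj : ∀ γ γs → holds γ ≡ true → (∀ {δ} → δ ∈ γs → holds δ ≡ true) → holds (conj γ γs) ≡ true
  holds-conj γ [] e _ = e
  holds-conj γ (δ ∷ δs) e h = ∧-true⁺ e (holds-conj δ δs (h (here refl)) (λ m → h (there m)))

  q-consistent : Consistent q
  q-consistent δ∈neg (γ , γs , γ∈pos , γs⊆pos , conj⊢δ) =
    true≢false (trans (sym (sound conj⊢δ root ρ₀ ι₀ ρ₀-InDomain ι₀-InDomain
                              (holds-conj γ γs (proj₂ (pos-q⁻ γ∈pos)) (λ m → proj₂ (pos-q⁻ (γs⊆pos m))))))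
                      (proj₂ (neg-q⁻ δ∈neg)))

  q-inside : InsideCl D Φ q
  q-inside = (λ m → closureSet-sound D Φ (proj₁ (pos-q⁻ m))) , (λ m → closureSet-sound D Φ (proj₁ (neg-q⁻ m)))

  q-maximal : ∀ q′ → Consistent q′ → pos q ⊆ pos q′ → neg q ⊆ neg q′ → InsideCl D Φ q′ →
    pos q′ ⊆ pos q × neg q′ ⊆ neg q
  q-maximal q′ q′-consistent pos⊆ neg⊆ (pos-inside , neg-inside) = pos⊆pos , neg⊆neg
    where
    pos⊆pos : pos q′ ⊆ pos q
    pos⊆pos {χ} χ∈pos with holds χ in e
    ... | true = pos-q⁺ (pos-inside χ∈pos) e
    ... | false = ⊥-elim (q′-consistent (neg⊆ (neg-q⁺ (pos-inside χ∈pos) e)) (∈⇒⊢s χ∈pos))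
    neg⊆neg : neg q′ ⊆ neg q
    neg⊆neg {χ} χ∈neg with holds χ in e
    ... | true = ⊥-elim (q′-consistent χ∈neg (∈⇒⊢s (pos⊆ (pos-q⁺ (neg-inside χ∈neg) e))))
    ... | false = neg-q⁺ (neg-inside χ∈neg) e

  q-witnessed : FullyWitnessed q
  q-witnessed {x} {θ} ∀θ∈neg with ∀θ∈Cl , ∀θ-fails ← neg-q⁻ ∀θ∈neg
    with d , d∈D , θ[d]-fails ← all-false⁻ (λ d → eval root (ρ₀ [ x ↦ d ]) ι₀ θ) D ∀θ-fails
    with γ , γ∈Φ , ∀θ∈Clγ ← closureSet-sound D Φ ∀θ∈Cl
    = d , neg-q⁺ (γ , γ∈Φ , InCl-trans (∀in d∈D here) ∀θ∈Clγ)
            (trans (eval-[←] θ root ρ₀ ι₀ x (con d) (freeFor-con θ x d))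
                   (trans (cong (λ v → eval root (ρ₀ [ x ↦ v ]) ι₀ θ) (ι₀-fix d∈D)) θ[d]-fails))

  ◇φ-fails : holds (◇ φ) ≡ false
  ◇φ-fails = ¬-not λ e → 1+n≰n (holds-md (◇ φ) e)
    where
    1+n≰n : ∀ {n} → suc n ≤ n → ⊥
    1+n≰n (s≤s h) = 1+n≰n h

  p-refutes : ∀ {ψ} → ◇ ψ ∈ neg p → φ ⊢ ψ ⊎ φ ⊢ ◇ ψ → ⊥
  p-refutes ◇ψ∈neg (inj₁ φ⊢ψ) = p-consistent ◇ψ∈neg (◇ φ , [] , ◇φ∈p , (λ ()) , r-◇ φ⊢ψ)
  p-refutes ◇ψ∈neg (inj₂ φ⊢◇ψ) =
    p-consistent ◇ψ∈neg (◇ φ , [] , ◇φ∈p , (λ ()) , r-cut (r-◇ φ⊢◇ψ) ax-◇◇)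

  p-R̂-q : R̂ p q
  p-R̂-q = boxes , φ , ◇φ∈p , neg-q⁺ (InClSet-mono C⊆D (proj₁ p-inside ◇φ∈p)) ◇φ-fails
    where
    boxes : ∀ {ψ} → ◇ ψ ∈ neg p → ψ ∈ neg q × ◇ ψ ∈ neg q
    boxes ◇ψ∈neg =
      neg-q⁺ (InClSet-mono C⊆D ψ∈Cl) (¬-not λ e → p-refutes ◇ψ∈neg (inj₁ (holds⇒derivable ψ∈Cl e))) ,
      neg-q⁺ (InClSet-mono C⊆D ◇ψ∈Cl) (¬-not λ e → p-refutes ◇ψ∈neg (inj₂ (holds⇒derivable ◇ψ∈Cl e)))
      where
      ◇ψ∈Cl = proj₂ p-inside ◇ψ∈neg
      ψ∈Cl = InClSet-◇ ◇ψ∈Cl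

  md-q<md-p : mdSet (pos q) < mdSet (pos p)
  md-q<md-p = <-≤-trans (s≤s (mdSet-lub (pos q) (λ {χ} m → holds-md χ (proj₂ (pos-q⁻ m))))) (md≤mdSet ◇φ∈p)

  φ∈q : φ ∈ pos q
  φ∈q = pos-q⁺ (InClSet-mono C⊆D φ∈Cl) holds-φ

lemma5p9 : (C : List ℕ) (Φ : List Formula) →
    (∀ {φ} → φ ∈ Φ → Closed φ × ConstsIn C φ) →
    (p : Pair) → ClMCW C Φ p →
    (φ : Formula) → ◇ φ ∈ pos p →
    ∃[ D ] ∃[ q ] ((C ⊆ D) × ClMCW D Φ q × R̂ p q × (φ ∈ pos q) ×
    (mdSet (pos q) < mdSet (pos p)))
lemma5p9 C Φ Φ-closed p ((p-inside , p-consistent , _) , _) φ ◇φ∈p =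
  D , q , C⊆D , ((q-inside , q-consistent , q-maximal) , q-witnessed) , p-R̂-q , φ∈q , md-q<md-p
  where
  open TruthLemma C (totalQuantifierDepth Φ) using (D; C⊆D)
  open Successor C Φ Φ-closed p p-inside p-consistent φ ◇φ∈p
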